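{- For every plane rooted tree $T$, $$Q(T)=\prod_{v\in V(T)}W(v),\qquad W(v)=\binom{|E(T^v)|}{|E(T^v_{k_v})|,\dots,|E(T^v_1)|}_q,$$ where for a vertex $v$, $T^v$ is the subtree of $T$ growing upward from $v$ (consisting of $v$ and all vertices and edges above it, rooted at $v$), and $T^v=T^v_{k_v}\vee\dots\vee T^v_1$ is its decomposition as a wedge (at $v$) of the $k_v$ branches of $T^v$ at $v$, listed from left to right.
   Context: A plane rooted tree is a finite tree with a distinguished vertex (the root), embedded in the plane so that it grows upward from the root. A leaf is a vertex of degree $1$ different from the root. For a leaf $v$ of $T$, $r(T,v)$ denotes the number of edges of $T$ lying to the right of the unique path connecting $v$ with the root, and $T-v$ is the plane rooted tree obtained by deleting $v$ and its incident edge. The plucking polynomial $Q(T)\in\mathbb{Z}[q]$ is defined recursively: if $T$ has a single vertex then $Q(T)=1$; otherwise $Q(T)=\sum_{v \text{ leaf of } T} q^{r(T,v)}Q(T-v)$. $k_v$ is the number of edges going upward from $v$; each branch $T^v_i$ consists of one such edge together with the subtree above its upper endpoint, rooted at $v$ (for $k_v=0$ the multinomial coefficient is the empty one, equal to $1$). Notation: $[n]_q=1+q+\dots+q^{n-1}$, $[0]_q!=1$, $[n]_q!=[n]_q\cdots[1]_q$, and $\binom{a_1+\dots+a_k}{a_1,\dots,a_k}_q=\frac{[a_1+\dots+a_k]_q!}{[a_1]_q!\cdots[a_k]_q!}$. -}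

module Defs where

open import Data.Nat using (ℕ; zero; suc; _∸_) renaming (_+_ to _+ℕ_)
open import Data.Integer using (ℤ; +_; 0ℤ; 1ℤ) renaming (_+_ to _+ℤ_; _*_ to _*ℤ_; -_ to -ℤ_)
open import Data.List using (List; []; _∷_; map; foldr; replicate; _++_; length; reverse)
open import Data.Product using (_×_; _,_)
open import Relation.Binary.PropositionalEquality using (_≡_)

-- Polynomials in ℤ[q], as coefficient lists (constant term first).
-- Trailing zeros are allowed; equality is coefficientwise (_≈P_).

Poly : Set
Poly = List ℤ

coeff : Poly → ℕ → ℤ
coeff []       _       = 0ℤ
coeff (a ∷ _)  zero    = a
coeff (_ ∷ p)  (suc i) = coeff p i

infix 4 _≈P_
_≈P_ : Poly → Poly → Set
p ≈P r = ∀ i → coeff p i ≡ coeff r i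

0P : Poly
0P = []

1P : Poly
1P = 1ℤ ∷ []

infixl 6 _+P_ _-P_
infixl 7 _*P_ _·P_

_+P_ : Poly → Poly → Poly
[]      +P r       = r
p       +P []      = p
(a ∷ p) +P (b ∷ r) = (a +ℤ b) ∷ (p +P r)

_·P_ : ℤ → Poly → Poly
c ·P p = map (c *ℤ_) p

_-P_ : Poly → Poly → Poly
p -P r = p +P ((-ℤ 1ℤ) ·P r)

_*P_ : Poly → Poly → Poly
[]      *P r = []
(a ∷ p) *P r = (a ·P r) +P (0ℤ ∷ (p *P r))

sumP : List Poly → Poly
sumP = foldr _+P_ 0P

prodP : List Poly → Poly
prodP = foldr _*P_ 1P

qPow : ℕ → Poly
qPow n = replicate n 0ℤ ++ (1ℤ ∷ [])

qInt : ℕ → Poly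
qInt n = replicate n 1ℤ

qFact : ℕ → Poly
qFact zero    = 1P
qFact (suc n) = qInt (suc n) *P qFact n

-- Exact division a / b for b with constant coefficient 1 (all divisors
-- used below are products of q-factorials, which have constant term 1
-- and leading coefficient 1).  Computed as the power-series quotient,
-- truncated after 'fuel' coefficients; whenever b divides a in ℤ[q] and
-- fuel ≥ deg a + 1, this is exactly the polynomial quotient a / b.
headℤ : Poly → ℤ
headℤ []      = 0ℤ
headℤ (a ∷ _) = a

tailP : Poly → Poly
tailP []      = []
tailP (_ ∷ p) = p

divSeries : ℕ → Poly → Poly → Poly
divSeries zero    a b = []
divSeries (suc k) a b = headℤ a ∷ divSeries k (tailP (a -P (headℤ a ·P b))) b

_÷P_ : Poly → Poly → Poly
a ÷P b = divSeries (length a) a b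

sumℕ : List ℕ → ℕ
sumℕ = foldr _+ℕ_ 0

qMultinomial : List ℕ → Poly
qMultinomial as = qFact (sumℕ as) ÷P prodP (map qFact as)

-- Plane rooted trees: a vertex together with the list of its upward
-- branches, listed from LEFT to RIGHT.

data Tree : Set where
  node : List Tree → Tree

mutual
  edges : Tree → ℕ
  edges (node ts) = edgesF ts

  -- number of edges of the branches t₁,…,tₖ hanging from one vertex
  -- (each branch = one edge + the subtree above it)
  edgesF : List Tree → ℕ
  edgesF []       = 0
  edgesF (t ∷ ts) = suc (edges t) +ℕ edgesF ts

-- Leaves of the tree whose root has upward branches ts (left to right).
-- For each leaf v we return (r(T,v) , branches of the root of T - v).
-- The root itself is never listed (a leaf is a non-root vertex of degree 1,
-- i.e. a non-root vertex without upward edges).  Leaves are listed left to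
-- right.  r counts edges strictly to the right of the path v → root: at each
-- vertex on the path, all edges of the branches to the right of the path.
leavesF : List Tree → List (ℕ × List Tree)
leavesF []                   = []
leavesF (node [] ∷ ts)       =
  (edgesF ts , ts) ∷ map (λ { (r , ts') → (r , node [] ∷ ts') }) (leavesF ts)
leavesF (node (s ∷ ss) ∷ ts) =
  map (λ { (r , ss') → (r +ℕ edgesF ts , node ss' ∷ ts) }) (leavesF (s ∷ ss))
  ++ map (λ { (r , ts') → (r , node (s ∷ ss) ∷ ts') }) (leavesF ts)

-- The fuel n is the number of edges (each deletion removes exactly one edge),
-- so fuel 0 corresponds exactly to the one-vertex tree.
plucking : ℕ → List Tree → Poly
plucking zero    ts = 1P
plucking (suc n) ts =
  sumP (map (λ { (r , ts') → qPow r *P plucking n ts' }) (leavesF ts))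

Q : Tree → Poly
Q (node ts) = plucking (edgesF ts) ts

-- W(v) for a vertex v whose upward branches are T^v_1,…,T^v_k (left to right):
-- the q-multinomial ( |E(T^v)| ; |E(T^v_k)|,…,|E(T^v_1)| )_q, where
-- |E(T^v_i)| = 1 + |E(subtree above the i-th upward edge)|.
W : List Tree → Poly
W ts = qMultinomial (reverse (map (λ t → suc (edges t)) ts))

mutual
  prodW : Tree → Poly
  prodW (node ts) = W ts *P prodWF ts

  prodWF : List Tree → Poly
  prodWF []       = 1P
  prodWF (t ∷ ts) = prodW t *P prodWF ts

module Submission where

-- Write B(T) for the product, over the vertices v of T, of the q-binomials
-- [a₁+…+aₖ ; a₁]_q · [a₂+…+aₖ ; a₂]_q ⋯ obtained by peeling off the upward
-- branches of v (sizes a₁,…,aₖ, left to right) one at a time.  The coefficient lists of Defs, up to coefficientwise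
--      equality, form a commutative semiring; this lets the ring solver do all
--      routine rearrangements of products and sums.
--  (2) q-multinomials.  [a+b]_q! = [a+b ; a]_q [a]_q! [b]_q!, hence a q-factorial
--      of a sum is the product of iterated q-binomials times the factorials of
--      the parts.  The power-series division in Defs is exact whenever the
--      quotient has small enough degree, so W(v) equals that product of
--      q-binomials, and Π_v W(v) = B(T).
--  (3) Leaves.  B satisfies the defining recursion of Q: summing
--      q^{r(T,v)} B(T - v) over the leaves v splits into the leaves in the first
--      branch and the leaves in the others, and the two parts add up by the
--      q-Pascal rule [e+b ; e] = q^b [e-1+b ; e-1] + [e+b-1 ; e].  Since the
--      recursion determines Q, Q(T) = B(T) = Π_v W(v).

open import Defs
open import Level using (0ℓ)
open import Data.Nat using (ℕ; zero; suc; pred; _+_; _*_; _≤_; _⊔_; z≤n; s≤s)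
import Data.Nat.Properties as ℕₚ
open import Data.Integer using (ℤ; 0ℤ; 1ℤ) renaming (_+_ to _+ℤ_; _*_ to _*ℤ_; -_ to -ℤ_)
import Data.Integer.Properties as ℤₚ
import Data.Integer.Tactic.RingSolver as ℤ-Solver
import Data.Nat.Tactic.RingSolver as ℕ-Solver
open import Data.List using (List; []; _∷_; map; _++_; length; reverse)
import Data.List.Properties as Listₚ
open import Data.List.Relation.Unary.All as All using (All; []; _∷_)
open import Data.List.Relation.Unary.All.Properties using (map⁺; ++⁺)
import Data.List.Relation.Binary.Permutation.Propositional.Properties as Perm
import Data.List.Relation.Binary.Permutation.Setoid.Properties as SetoidPerm
open import Data.Nat.ListAction.Properties using (sum-↭)
open import Data.Product using (_×_; _,_)
open import Relation.Binary.PropositionalEquality using (_≡_; refl; sym; trans; cong; cong₂; module ≡-Reasoning)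
import Relation.Binary.Reasoning.Setoid
open import Relation.Binary.Bundles using (Setoid)
open import Algebra.Bundles using (CommutativeSemiring)
open import Algebra.Structures using (IsCommutativeMonoid)
open import Algebra.Structures.Biased using (isCommutativeSemiringˡ)
open import Data.Maybe using (nothing)
open import Tactic.RingSolver.Core.AlmostCommutativeRing using (AlmostCommutativeRing; fromCommutativeSemiring)
open import Tactic.RingSolver using (solve-∀)

-- Coefficientwise equality, wrapped in a record so that the two polynomials
-- can be inferred from a proof (unlike the bare function type _≈P_).

infix 4 _≋_
record _≋_ (p r : Poly) : Set where
  constructor coeffwise
  field coeff-≡ : ∀ i → coeff p i ≡ coeff r i
open _≋_

≋-refl : ∀ {p} → p ≋ p
≋-refl = coeffwise λ _ → refl

≋-reflexive : ∀ {p r} → p ≡ r → p ≋ r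
≋-reflexive refl = ≋-refl

≋-sym : ∀ {p r} → p ≋ r → r ≋ p
≋-sym e = coeffwise λ i → sym (coeff-≡ e i)

≋-trans : ∀ {p r s} → p ≋ r → r ≋ s → p ≋ s
≋-trans e f = coeffwise λ i → trans (coeff-≡ e i) (coeff-≡ f i)

PolySetoid : Setoid 0ℓ 0ℓ
PolySetoid = record
  { Carrier = Poly ; _≈_ = _≋_
  ; isEquivalence = record { refl = ≋-refl ; sym = ≋-sym ; trans = ≋-trans } }

module ≋-Reasoning = Relation.Binary.Reasoning.Setoid PolySetoid

coeff-+ : ∀ p r i → coeff (p +P r) i ≡ coeff p i +ℤ coeff r i
coeff-+ []      r       i       = sym (ℤₚ.+-identityˡ _)
coeff-+ (a ∷ p) []      i       = sym (ℤₚ.+-identityʳ _)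
coeff-+ (a ∷ p) (b ∷ r) zero    = refl
coeff-+ (a ∷ p) (b ∷ r) (suc i) = coeff-+ p r i

coeff-· : ∀ c p i → coeff (c ·P p) i ≡ c *ℤ coeff p i
coeff-· c []      i       = sym (ℤₚ.*-zeroʳ c)
coeff-· c (a ∷ p) zero    = refl
coeff-· c (a ∷ p) (suc i) = coeff-· c p i

coeff-∷* : ∀ a p r i → coeff ((a ∷ p) *P r) i ≡ a *ℤ coeff r i +ℤ coeff (0ℤ ∷ p *P r) i
coeff-∷* a p r i = trans (coeff-+ (a ·P r) _ i) (cong (_+ℤ coeff (0ℤ ∷ p *P r) i) (coeff-· a r i))

coeff-shift-+ : ∀ x y i → coeff (0ℤ ∷ (x +P y)) i ≡ coeff (0ℤ ∷ x) i +ℤ coeff (0ℤ ∷ y) i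
coeff-shift-+ x y zero    = refl
coeff-shift-+ x y (suc i) = coeff-+ x y i

coeff-shift-· : ∀ c x i → coeff (0ℤ ∷ (c ·P x)) i ≡ c *ℤ coeff (0ℤ ∷ x) i
coeff-shift-· c x zero    = sym (ℤₚ.*-zeroʳ c)
coeff-shift-· c x (suc i) = coeff-· c x i

shift-cong : ∀ {p p'} → p ≋ p' → (0ℤ ∷ p) ≋ (0ℤ ∷ p')
shift-cong e = coeffwise λ { zero → refl ; (suc i) → coeff-≡ e i }

+P-cong : ∀ {p p' r r'} → p ≋ p' → r ≋ r' → (p +P r) ≋ (p' +P r')
+P-cong {p} {p'} {r} {r'} e f = coeffwise λ i →
  trans (coeff-+ p r i) (trans (cong₂ _+ℤ_ (coeff-≡ e i) (coeff-≡ f i)) (sym (coeff-+ p' r' i)))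

·P-cong : ∀ c {p p'} → p ≋ p' → (c ·P p) ≋ (c ·P p')
·P-cong c {p} {p'} e = coeffwise λ i →
  trans (coeff-· c p i) (trans (cong (c *ℤ_) (coeff-≡ e i)) (sym (coeff-· c p' i)))

*P-congʳ : ∀ p {r r'} → r ≋ r' → (p *P r) ≋ (p *P r')
*P-congʳ []      e = ≋-refl
*P-congʳ (a ∷ p) e = +P-cong (·P-cong a e) (shift-cong (*P-congʳ p e))

+P-assoc : ∀ p r s → ((p +P r) +P s) ≋ (p +P (r +P s))
+P-assoc p r s = coeffwise λ i → lemma i
  where
  lemma : ∀ i → coeff ((p +P r) +P s) i ≡ coeff (p +P (r +P s)) i
  lemma i rewrite coeff-+ (p +P r) s i | coeff-+ p r i | coeff-+ p (r +P s) i | coeff-+ r s i =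
    ℤₚ.+-assoc (coeff p i) (coeff r i) (coeff s i)

+P-comm : ∀ p r → (p +P r) ≋ (r +P p)
+P-comm p r = coeffwise λ i →
  trans (coeff-+ p r i) (trans (ℤₚ.+-comm (coeff p i) (coeff r i)) (sym (coeff-+ r p i)))

+P-identityʳ : ∀ p → (p +P []) ≋ p
+P-identityʳ p = coeffwise λ i → trans (coeff-+ p [] i) (ℤₚ.+-identityʳ _)

*P-zeroʳ : ∀ p → (p *P []) ≋ []
*P-zeroʳ []      = ≋-refl
*P-zeroʳ (a ∷ p) = coeffwise λ { zero → refl ; (suc i) → coeff-≡ (*P-zeroʳ p) i }

*P-identityˡ : ∀ p → (1P *P p) ≋ p
*P-identityˡ p = coeffwise λ i → trans (coeff-∷* 1ℤ [] p i) (lemma i)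
  where
  lemma : ∀ i → 1ℤ *ℤ coeff p i +ℤ coeff (0ℤ ∷ []) i ≡ coeff p i
  lemma zero    = trans (ℤₚ.+-identityʳ _) (ℤₚ.*-identityˡ _)
  lemma (suc i) = trans (ℤₚ.+-identityʳ _) (ℤₚ.*-identityˡ _)

shift-* : ∀ x s → ((0ℤ ∷ x) *P s) ≋ (0ℤ ∷ (x *P s))
shift-* x s = coeffwise λ i → trans (coeff-∷* 0ℤ x s i) (zero-term (coeff s i) _)
  where
  zero-term : ∀ u v → 0ℤ *ℤ u +ℤ v ≡ v
  zero-term = ℤ-Solver.solve-∀

*P-∷ʳ : ∀ r a p → (r *P (a ∷ p)) ≋ ((a ·P r) +P (0ℤ ∷ (r *P p)))
*P-∷ʳ []      a p = coeffwise λ { zero → refl ; (suc i) → refl }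
*P-∷ʳ (b ∷ r) a p = coeffwise coefficient
  where
  open ≡-Reasoning
  exchange : ∀ x y z → x +ℤ (y +ℤ z) ≡ y +ℤ (x +ℤ z)
  exchange = ℤ-Solver.solve-∀
  coefficient : ∀ i → coeff ((b ∷ r) *P (a ∷ p)) i ≡ coeff (a ·P (b ∷ r) +P (0ℤ ∷ (b ∷ r) *P p)) i
  coefficient zero    = cong (_+ℤ 0ℤ) (ℤₚ.*-comm b a)
  coefficient (suc i) = begin
    coeff (b ·P p +P r *P (a ∷ p)) i
      ≡⟨ coeff-+ (b ·P p) _ i ⟩
    coeff (b ·P p) i +ℤ coeff (r *P (a ∷ p)) i
      ≡⟨ cong₂ _+ℤ_ (coeff-· b p i) (trans (coeff-≡ (*P-∷ʳ r a p) i) (coeff-+ (a ·P r) _ i)) ⟩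
    b *ℤ coeff p i +ℤ (coeff (a ·P r) i +ℤ coeff (0ℤ ∷ r *P p) i)
      ≡⟨ exchange (b *ℤ coeff p i) (coeff (a ·P r) i) _ ⟩
    coeff (a ·P r) i +ℤ (b *ℤ coeff p i +ℤ coeff (0ℤ ∷ r *P p) i)
      ≡⟨ cong (coeff (a ·P r) i +ℤ_) (sym (coeff-∷* b r p i)) ⟩
    coeff (a ·P r) i +ℤ coeff ((b ∷ r) *P p) i
      ≡⟨ sym (coeff-+ (a ·P r) ((b ∷ r) *P p) i) ⟩
    coeff (a ·P r +P (b ∷ r) *P p) i ∎

*P-comm : ∀ p r → (p *P r) ≋ (r *P p)
*P-comm []      r = ≋-sym (*P-zeroʳ r)
*P-comm (a ∷ p) r = ≋-trans (+P-cong (≋-refl {a ·P r}) (shift-cong (*P-comm p r))) (≋-sym (*P-∷ʳ r a p))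

*P-congˡ : ∀ {p p'} r → p ≋ p' → (p *P r) ≋ (p' *P r)
*P-congˡ {p} {p'} r e = ≋-trans (*P-comm p r) (≋-trans (*P-congʳ r e) (*P-comm r p'))

*P-cong : ∀ {p p' r r'} → p ≋ p' → r ≋ r' → (p *P r) ≋ (p' *P r')
*P-cong {p' = p'} {r = r} e f = ≋-trans (*P-congˡ r e) (*P-congʳ p' f)

·P-*P-assoc : ∀ c p r → ((c ·P p) *P r) ≋ (c ·P (p *P r))
·P-*P-assoc c []      r = ≋-refl
·P-*P-assoc c (a ∷ p) r = coeffwise coefficient
  where
  open ≡-Reasoning
  factor : ∀ x y z w → (x *ℤ y) *ℤ z +ℤ x *ℤ w ≡ x *ℤ (y *ℤ z +ℤ w)
  factor = ℤ-Solver.solve-∀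
  coefficient : ∀ i → coeff ((c ·P (a ∷ p)) *P r) i ≡ coeff (c ·P ((a ∷ p) *P r)) i
  coefficient i = begin
    coeff (((c *ℤ a) ∷ (c ·P p)) *P r) i
      ≡⟨ coeff-∷* (c *ℤ a) (c ·P p) r i ⟩
    (c *ℤ a) *ℤ coeff r i +ℤ coeff (0ℤ ∷ (c ·P p) *P r) i
      ≡⟨ cong ((c *ℤ a) *ℤ coeff r i +ℤ_)
              (trans (coeff-≡ (shift-cong (·P-*P-assoc c p r)) i) (coeff-shift-· c (p *P r) i)) ⟩
    (c *ℤ a) *ℤ coeff r i +ℤ c *ℤ coeff (0ℤ ∷ p *P r) i
      ≡⟨ factor c a (coeff r i) _ ⟩
    c *ℤ (a *ℤ coeff r i +ℤ coeff (0ℤ ∷ p *P r) i)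
      ≡⟨ cong (c *ℤ_) (sym (coeff-∷* a p r i)) ⟩
    c *ℤ coeff ((a ∷ p) *P r) i
      ≡⟨ sym (coeff-· c ((a ∷ p) *P r) i) ⟩
    coeff (c ·P ((a ∷ p) *P r)) i ∎

*P-distribʳ : ∀ s p r → ((p +P r) *P s) ≋ ((p *P s) +P (r *P s))
*P-distribʳ s []      r       = ≋-refl
*P-distribʳ s (a ∷ p) []      = ≋-sym (+P-identityʳ _)
*P-distribʳ s (a ∷ p) (b ∷ r) = coeffwise coefficient
  where
  open ≡-Reasoning
  regroup : ∀ a b x y z → (a +ℤ b) *ℤ x +ℤ (y +ℤ z) ≡ (a *ℤ x +ℤ y) +ℤ (b *ℤ x +ℤ z)
  regroup = ℤ-Solver.solve-∀
  coefficient : ∀ i → coeff ((a +ℤ b ∷ p +P r) *P s) i ≡ coeff ((a ∷ p) *P s +P (b ∷ r) *P s) i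
  coefficient i = begin
    coeff ((a +ℤ b ∷ p +P r) *P s) i
      ≡⟨ coeff-∷* (a +ℤ b) (p +P r) s i ⟩
    (a +ℤ b) *ℤ coeff s i +ℤ coeff (0ℤ ∷ (p +P r) *P s) i
      ≡⟨ cong ((a +ℤ b) *ℤ coeff s i +ℤ_)
              (trans (coeff-≡ (shift-cong (*P-distribʳ s p r)) i) (coeff-shift-+ (p *P s) (r *P s) i)) ⟩
    (a +ℤ b) *ℤ coeff s i +ℤ (coeff (0ℤ ∷ p *P s) i +ℤ coeff (0ℤ ∷ r *P s) i)
      ≡⟨ regroup a b (coeff s i) _ _ ⟩
    (a *ℤ coeff s i +ℤ coeff (0ℤ ∷ p *P s) i) +ℤ (b *ℤ coeff s i +ℤ coeff (0ℤ ∷ r *P s) i)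
      ≡⟨ sym (cong₂ _+ℤ_ (coeff-∷* a p s i) (coeff-∷* b r s i)) ⟩
    coeff ((a ∷ p) *P s) i +ℤ coeff ((b ∷ r) *P s) i
      ≡⟨ sym (coeff-+ ((a ∷ p) *P s) _ i) ⟩
    coeff ((a ∷ p) *P s +P (b ∷ r) *P s) i ∎

*P-assoc : ∀ p r s → ((p *P r) *P s) ≋ (p *P (r *P s))
*P-assoc []      r s = ≋-refl
*P-assoc (a ∷ p) r s = begin
  ((a ·P r) +P (0ℤ ∷ p *P r)) *P s            ≈⟨ *P-distribʳ s (a ·P r) (0ℤ ∷ p *P r) ⟩
  ((a ·P r) *P s) +P ((0ℤ ∷ p *P r) *P s)     ≈⟨ +P-cong (·P-*P-assoc a r s) (shift-* (p *P r) s) ⟩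
  (a ·P (r *P s)) +P (0ℤ ∷ (p *P r) *P s)     ≈⟨ +P-cong (≋-refl {a ·P (r *P s)}) (shift-cong (*P-assoc p r s)) ⟩
  (a ·P (r *P s)) +P (0ℤ ∷ p *P (r *P s))     ∎
  where open ≋-Reasoning

+P-isCommutativeMonoid : IsCommutativeMonoid _≋_ _+P_ []
+P-isCommutativeMonoid = record
  { isMonoid = record
    { isSemigroup = record
      { isMagma = record { isEquivalence = Setoid.isEquivalence PolySetoid ; ∙-cong = +P-cong }
      ; assoc = +P-assoc }
    ; identity = (λ _ → ≋-refl) , +P-identityʳ }
  ; comm = +P-comm }

*P-isCommutativeMonoid : IsCommutativeMonoid _≋_ _*P_ 1P
*P-isCommutativeMonoid = record
  { isMonoid = record
    { isSemigroup = record
      { isMagma = record { isEquivalence = Setoid.isEquivalence PolySetoid ; ∙-cong = *P-cong }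
      ; assoc = *P-assoc }
    ; identity = *P-identityˡ , (λ p → ≋-trans (*P-comm p 1P) (*P-identityˡ p)) }
  ; comm = *P-comm }

Poly-commutativeSemiring : CommutativeSemiring 0ℓ 0ℓ
Poly-commutativeSemiring = record
  { Carrier = Poly ; _≈_ = _≋_ ; _+_ = _+P_ ; _*_ = _*P_ ; 0# = [] ; 1# = 1P
  ; isCommutativeSemiring = isCommutativeSemiringˡ record
      { +-isCommutativeMonoid = +P-isCommutativeMonoid
      ; *-isCommutativeMonoid = *P-isCommutativeMonoid
      ; distribʳ = *P-distribʳ
      ; zeroˡ = λ _ → ≋-refl } }

PolyRing : AlmostCommutativeRing 0ℓ 0ℓ
PolyRing = fromCommutativeSemiring Poly-commutativeSemiring (λ _ → nothing)

-- q-binomials and q-factorials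

-- qbin a b = [a+b ; a]_q, defined by the q-Pascal rule
--   [a+b+2 ; a+1] = q^{b+1} [a+b+1 ; a] + [a+b+1 ; a+1].
qbin : ℕ → ℕ → Poly
qbin zero    b       = 1P
qbin (suc a) zero    = 1P
qbin (suc a) (suc b) = (qPow (suc b) *P qbin a (suc b)) +P qbin (suc a) b

qbin-zeroʳ : ∀ a → qbin a 0 ≡ 1P
qbin-zeroʳ zero    = refl
qbin-zeroʳ (suc a) = refl

qInt-+ : ∀ n m → (qInt n +P (qPow n *P qInt m)) ≋ qInt (n + m)
qInt-+ zero    m = *P-identityˡ (qInt m)
qInt-+ (suc n) m = ≋-trans (+P-cong (≋-refl {qInt (suc n)}) (shift-* (qPow n) (qInt m)))
                           (coeffwise λ { zero → refl ; (suc i) → coeff-≡ (qInt-+ n m) i })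

qPow-+ : ∀ m n → qPow (m + n) ≋ (qPow m *P qPow n)
qPow-+ zero    n = ≋-sym (*P-identityˡ (qPow n))
qPow-+ (suc m) n = ≋-trans (shift-cong (qPow-+ m n)) (≋-sym (shift-* (qPow m) (qPow n)))

qFact-+ : ∀ a b → qFact (a + b) ≋ (qbin a b *P (qFact a *P qFact b))
qFact-+ zero    b       = ≋-sym (unit (qFact b))
  where
  unit : ∀ x → (1P *P (1P *P x)) ≋ x
  unit = solve-∀ PolyRing
qFact-+ (suc a) zero    = ≋-trans (≋-reflexive (cong qFact (ℕₚ.+-identityʳ (suc a))))
                                  (≋-sym (unit (qFact (suc a))))
  where
  unit : ∀ x → (1P *P (x *P 1P)) ≋ x
  unit = solve-∀ PolyRing
qFact-+ (suc a) (suc b) = ≋-sym (begin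
    ((P *P C₁) +P C₂) *P ((Ia *P Fa) *P (Ib *P Fb))
  ≈⟨ expand P C₁ C₂ Ia Ib Fa Fb ⟩
    ((P *P Ia) *P (C₁ *P (Fa *P (Ib *P Fb)))) +P (Ib *P (C₂ *P ((Ia *P Fa) *P Fb)))
  ≈⟨ +P-cong (*P-congʳ (P *P Ia) (≋-sym (qFact-+ a (suc b))))
             (*P-congʳ Ib (≋-sym (≋-trans (≋-reflexive (cong qFact (ℕₚ.+-suc a b))) (qFact-+ (suc a) b)))) ⟩
    ((P *P Ia) *P X) +P (Ib *P X)
  ≈⟨ collect (P *P Ia) Ib X ⟩
    (Ib +P (P *P Ia)) *P X
  ≈⟨ *P-congˡ X (≋-trans (qInt-+ (suc b) (suc a)) (≋-reflexive (cong qInt size))) ⟩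
    qInt (suc (a + suc b)) *P X
  ∎)
  where
  open ≋-Reasoning
  P = qPow (suc b)
  C₁ = qbin a (suc b)
  C₂ = qbin (suc a) b
  Ia = qInt (suc a)
  Ib = qInt (suc b)
  Fa = qFact a
  Fb = qFact b
  X = qFact (a + suc b)
  expand : ∀ P C₁ C₂ Ia Ib Fa Fb → (((P *P C₁) +P C₂) *P ((Ia *P Fa) *P (Ib *P Fb)))
           ≋ (((P *P Ia) *P (C₁ *P (Fa *P (Ib *P Fb)))) +P (Ib *P (C₂ *P ((Ia *P Fa) *P Fb))))
  expand = solve-∀ PolyRing
  collect : ∀ A B X → ((A *P X) +P (B *P X)) ≋ ((B +P A) *P X)
  collect = solve-∀ PolyRing
  size : suc b + suc a ≡ suc (a + suc b)
  size = cong suc (trans (ℕₚ.+-comm b (suc a)) (sym (ℕₚ.+-suc a b)))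

binomials : List ℕ → Poly
binomials []       = 1P
binomials (a ∷ as) = qbin a (sumℕ as) *P binomials as

qFact-sum : ∀ as → qFact (sumℕ as) ≋ (binomials as *P prodP (map qFact as))
qFact-sum []       = ≋-sym (*P-identityˡ 1P)
qFact-sum (a ∷ as) = begin
  qFact (a + sumℕ as)
    ≈⟨ qFact-+ a (sumℕ as) ⟩
  C *P (qFact a *P qFact (sumℕ as))
    ≈⟨ *P-congʳ C (*P-congʳ (qFact a) (qFact-sum as)) ⟩
  C *P (qFact a *P (binomials as *P prodP (map qFact as)))
    ≈⟨ regroup C (qFact a) (binomials as) (prodP (map qFact as)) ⟩
  (C *P binomials as) *P (qFact a *P prodP (map qFact as)) ∎
  where
  open ≋-Reasoning
  C = qbin a (sumℕ as)
  regroup : ∀ C F M R → (C *P (F *P (M *P R))) ≋ ((C *P M) *P (F *P R))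
  regroup = solve-∀ PolyRing

sum-reverse : ∀ as → sumℕ (reverse as) ≡ sumℕ as
sum-reverse as = sum-↭ (Perm.↭-reverse as)

prodP-reverse : ∀ ps → prodP (reverse ps) ≋ prodP ps
prodP-reverse ps = SetoidPerm.foldr-commMonoid PolySetoid *P-isCommutativeMonoid (SetoidPerm.↭-reverse PolySetoid ps)

qFact-sum-reverse : ∀ as → qFact (sumℕ (reverse as)) ≋ (binomials as *P prodP (map qFact (reverse as)))
qFact-sum-reverse as = begin
  qFact (sumℕ (reverse as))                       ≡⟨ cong qFact (sum-reverse as) ⟩
  qFact (sumℕ as)                                 ≈⟨ qFact-sum as ⟩
  binomials as *P prodP (map qFact as)            ≈⟨ *P-congʳ (binomials as) (prodP-reverse (map qFact as)) ⟨
  binomials as *P prodP (reverse (map qFact as))  ≡⟨ cong (λ ps → binomials as *P prodP ps)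
                                                          (Listₚ.reverse-map qFact as) ⟨
  binomials as *P prodP (map qFact (reverse as))  ∎
  where open ≋-Reasoning

-- Exact division

truncate : ℕ → Poly → Poly
truncate zero    c = []
truncate (suc k) c = headℤ c ∷ truncate k (tailP c)

head-coeff : ∀ c → headℤ c ≡ coeff c 0
head-coeff []      = refl
head-coeff (x ∷ c) = refl

tail-coeff : ∀ c i → coeff (tailP c) i ≡ coeff c (suc i)
tail-coeff []      i = refl
tail-coeff (x ∷ c) i = refl

head∷tail : ∀ c → c ≋ (headℤ c ∷ tailP c)
head∷tail []      = coeffwise λ { zero → refl ; (suc i) → refl }
head∷tail (x ∷ c) = ≋-refl

-- Power-series division by b with b(0) = 1 computes the quotient c of
-- a = c·b coefficient by coefficient: the leading term of a is that of c, and
-- removing c(0)·b from a leaves q·(tail c)·b.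
divSeries-exact : ∀ k a b c → coeff b 0 ≡ 1ℤ → a ≋ (c *P b) → divSeries k a b ≋ truncate k c
divSeries-exact zero    a b c b₀ a≋cb = ≋-refl
divSeries-exact (suc k) a b c b₀ a≋cb =
  coeffwise λ { zero → head-agrees ; (suc i) → coeff-≡ (divSeries-exact k _ b t b₀ remainder) i }
  where
  h = headℤ c
  t = tailP c
  a≋ht·b : a ≋ ((h ∷ t) *P b)
  a≋ht·b = ≋-trans a≋cb (*P-congˡ b (head∷tail c))
  unit : ∀ x → x *ℤ 1ℤ +ℤ 0ℤ ≡ x
  unit = ℤ-Solver.solve-∀
  cancel : ∀ x y z → (x *ℤ y +ℤ z) +ℤ (-ℤ 1ℤ) *ℤ (x *ℤ y) ≡ z
  cancel = ℤ-Solver.solve-∀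
  head-agrees : headℤ a ≡ h
  head-agrees = begin
    headℤ a             ≡⟨ head-coeff a ⟩
    coeff a 0           ≡⟨ trans (coeff-≡ a≋ht·b 0) (coeff-∷* h t b 0) ⟩
    h *ℤ coeff b 0 +ℤ 0ℤ ≡⟨ cong (λ z → h *ℤ z +ℤ 0ℤ) b₀ ⟩
    h *ℤ 1ℤ +ℤ 0ℤ       ≡⟨ unit h ⟩
    h                   ∎
    where open ≡-Reasoning
  remainder : tailP (a -P (headℤ a ·P b)) ≋ (t *P b)
  remainder = coeffwise λ i → begin
    coeff (tailP (a -P (headℤ a ·P b))) i
      ≡⟨ trans (tail-coeff (a -P (headℤ a ·P b)) i) (coeff-+ a _ (suc i)) ⟩
    coeff a (suc i) +ℤ coeff ((-ℤ 1ℤ) ·P (headℤ a ·P b)) (suc i)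
      ≡⟨ cong₂ _+ℤ_ (trans (coeff-≡ a≋ht·b (suc i)) (coeff-∷* h t b (suc i)))
                     (trans (coeff-· (-ℤ 1ℤ) (headℤ a ·P b) (suc i))
                            (cong ((-ℤ 1ℤ) *ℤ_) (coeff-· (headℤ a) b (suc i)))) ⟩
    (h *ℤ coeff b (suc i) +ℤ coeff (t *P b) i) +ℤ (-ℤ 1ℤ) *ℤ (headℤ a *ℤ coeff b (suc i))
      ≡⟨ cong (λ z → (h *ℤ coeff b (suc i) +ℤ coeff (t *P b) i) +ℤ (-ℤ 1ℤ) *ℤ (z *ℤ coeff b (suc i)))
              head-agrees ⟩
    (h *ℤ coeff b (suc i) +ℤ coeff (t *P b) i) +ℤ (-ℤ 1ℤ) *ℤ (h *ℤ coeff b (suc i))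
      ≡⟨ cancel h (coeff b (suc i)) (coeff (t *P b) i) ⟩
    coeff (t *P b) i ∎
    where open ≡-Reasoning

DegreeBelow : Poly → ℕ → Set
DegreeBelow p n = ∀ i → n ≤ i → coeff p i ≡ 0ℤ

truncate-DegreeBelow : ∀ k c → DegreeBelow c k → truncate k c ≋ c
truncate-DegreeBelow zero    c c<k = coeffwise λ i → sym (c<k i z≤n)
truncate-DegreeBelow (suc k) c c<k = coeffwise λ
  { zero    → head-coeff c
  ; (suc i) → trans (coeff-≡ (truncate-DegreeBelow k (tailP c) tail<k) i) (tail-coeff c i) }
  where
  tail<k : DegreeBelow (tailP c) k
  tail<k j k≤j = trans (tail-coeff c j) (c<k (suc j) (s≤s k≤j))

÷P-exact : ∀ a b c → coeff b 0 ≡ 1ℤ → a ≋ (c *P b) → DegreeBelow c (length a) → (a ÷P b) ≋ c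
÷P-exact a b c b₀ a≋cb c<a =
  ≋-trans (divSeries-exact (length a) a b c b₀ a≋cb) (truncate-DegreeBelow (length a) c c<a)

-- Degree bounds that make the division in qMultinomial exact

DegreeBelow-mono : ∀ {p m n} → m ≤ n → DegreeBelow p m → DegreeBelow p n
DegreeBelow-mono m≤n p<m i n≤i = p<m i (ℕₚ.≤-trans m≤n n≤i)

DegreeBelow-+ : ∀ {p r n} → DegreeBelow p n → DegreeBelow r n → DegreeBelow (p +P r) n
DegreeBelow-+ {p} {r} p<n r<n i n≤i = trans (coeff-+ p r i) (cong₂ _+ℤ_ (p<n i n≤i) (r<n i n≤i))

DegreeBelow-* : ∀ p r m n → DegreeBelow p m → DegreeBelow r (suc n) → DegreeBelow (p *P r) (m + n)
DegreeBelow-* []      r m       n p<m r<n i       le        = refl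
DegreeBelow-* (a ∷ p) r zero    n p<m r<n i       le        =
  coeff-≡ (*P-congˡ {a ∷ p} {[]} r (coeffwise λ j → p<m j z≤n)) i
DegreeBelow-* (a ∷ p) r (suc m) n p<m r<n (suc i) (s≤s m+n≤i) = begin
  coeff ((a ∷ p) *P r) (suc i)             ≡⟨ coeff-∷* a p r (suc i) ⟩
  a *ℤ coeff r (suc i) +ℤ coeff (p *P r) i ≡⟨ cong₂ (λ u v → a *ℤ u +ℤ v)
                                                     (r<n (suc i) (s≤s n≤i)) tail-vanishes ⟩
  a *ℤ 0ℤ +ℤ 0ℤ                            ≡⟨ cong (_+ℤ 0ℤ) (ℤₚ.*-zeroʳ a) ⟩
  0ℤ                                       ∎
  where
  open ≡-Reasoning
  n≤i = ℕₚ.≤-trans (ℕₚ.m≤n+m n m) m+n≤i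
  tail-vanishes = DegreeBelow-* p r m n (λ j m≤j → p<m (suc j) (s≤s m≤j)) r<n i m+n≤i

DegreeBelow-1P : DegreeBelow 1P 1
DegreeBelow-1P (suc i) le = refl

DegreeBelow-qPow : ∀ n → DegreeBelow (qPow n) (suc n)
DegreeBelow-qPow zero    (suc i) le        = refl
DegreeBelow-qPow (suc n) (suc i) (s≤s le) = DegreeBelow-qPow n i le

DegreeBelow-qbin : ∀ a b → DegreeBelow (qbin a b) (suc (a * b))
DegreeBelow-qbin zero    b       = DegreeBelow-1P
DegreeBelow-qbin (suc a) zero    = DegreeBelow-mono {1P} (s≤s z≤n) DegreeBelow-1P
DegreeBelow-qbin (suc a) (suc b) = DegreeBelow-+ {qPow (suc b) *P qbin a (suc b)}
  (DegreeBelow-* (qPow (suc b)) (qbin a (suc b)) (suc (suc b)) (a * suc b)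
                 (DegreeBelow-qPow (suc b)) (DegreeBelow-qbin a (suc b)))
  (DegreeBelow-mono {qbin (suc a) b} (s≤s (ℕₚ.*-monoʳ-≤ (suc a) (ℕₚ.n≤1+n b))) (DegreeBelow-qbin (suc a) b))

binomialsDegree : List ℕ → ℕ
binomialsDegree []       = 0
binomialsDegree (a ∷ as) = a * sumℕ as + binomialsDegree as

DegreeBelow-binomials : ∀ as → DegreeBelow (binomials as) (suc (binomialsDegree as))
DegreeBelow-binomials []       = DegreeBelow-1P
DegreeBelow-binomials (a ∷ as) =
  DegreeBelow-* (qbin a (sumℕ as)) (binomials as) (suc (a * sumℕ as)) (binomialsDegree as)
                (DegreeBelow-qbin a (sumℕ as)) (DegreeBelow-binomials as)

-- triangle n = 0 + 1 + … + (n-1), the degree of [n]_q!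
triangle : ℕ → ℕ
triangle zero    = 0
triangle (suc n) = n + triangle n

triangle-+ : ∀ a b → triangle (a + b) ≡ triangle a + triangle b + a * b
triangle-+ zero    b = sym (ℕₚ.+-identityʳ (triangle b))
triangle-+ (suc a) b = trans (cong (a + b +_) (triangle-+ a b)) (regroup a b (triangle a) (triangle b))
  where
  regroup : ∀ a b x y → (a + b) + (x + y + a * b) ≡ (a + x) + y + (b + a * b)
  regroup = ℕ-Solver.solve-∀

binomialsDegree≤triangle : ∀ as → binomialsDegree as ≤ triangle (sumℕ as)
binomialsDegree≤triangle []       = z≤n
binomialsDegree≤triangle (a ∷ as) = begin
  a * s + binomialsDegree as   ≤⟨ ℕₚ.+-monoʳ-≤ (a * s) (binomialsDegree≤triangle as) ⟩
  a * s + triangle s           ≤⟨ ℕₚ.m≤n+m (a * s + triangle s) (triangle a) ⟩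
  triangle a + (a * s + triangle s) ≡⟨ regroup (triangle a) (a * s) (triangle s) ⟩
  triangle a + triangle s + a * s   ≡⟨ triangle-+ a s ⟨
  triangle (a + s)             ∎
  where
  open ℕₚ.≤-Reasoning
  s = sumℕ as
  regroup : ∀ x y z → x + (y + z) ≡ x + z + y
  regroup = ℕ-Solver.solve-∀

length-+P : ∀ p r → length (p +P r) ≡ length p ⊔ length r
length-+P []      r       = refl
length-+P (a ∷ p) []      = refl
length-+P (a ∷ p) (b ∷ r) = cong suc (length-+P p r)

length-*P : ∀ p r m n → length p ≡ suc m → length r ≡ suc n → length (p *P r) ≡ suc (m + n)
length-*P (a ∷ [])     r       zero    n refl r≡ = begin
  length ((a ·P r) +P (0ℤ ∷ []))  ≡⟨ length-+P (a ·P r) (0ℤ ∷ []) ⟩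
  length (a ·P r) ⊔ 1             ≡⟨ cong (_⊔ 1) (trans (Listₚ.length-map (a *ℤ_) r) r≡) ⟩
  suc n ⊔ 1                       ≡⟨ cong suc (ℕₚ.⊔-identityʳ n) ⟩
  suc n                           ∎
  where open ≡-Reasoning
length-*P (a ∷ a' ∷ p) r       (suc m) n p≡ r≡ = begin
  length ((a ·P r) +P (0ℤ ∷ (a' ∷ p) *P r))    ≡⟨ length-+P (a ·P r) (0ℤ ∷ (a' ∷ p) *P r) ⟩
  length (a ·P r) ⊔ suc (length ((a' ∷ p) *P r)) ≡⟨ cong₂ _⊔_ (trans (Listₚ.length-map (a *ℤ_) r) r≡)
                                                          (cong suc (length-*P (a' ∷ p) r m n (ℕₚ.suc-injective p≡) r≡)) ⟩
  suc n ⊔ suc (suc (m + n))                     ≡⟨ ℕₚ.m≤n⇒m⊔n≡n (s≤s (ℕₚ.m≤n⇒m≤1+n (ℕₚ.m≤n+m n m))) ⟩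
  suc (suc m + n)                               ∎
  where open ≡-Reasoning

length-qFact : ∀ n → length (qFact n) ≡ suc (triangle n)
length-qFact zero    = refl
length-qFact (suc n) = length-*P (qInt (suc n)) (qFact n) n (triangle n)
                                 (cong suc (Listₚ.length-replicate n)) (length-qFact n)

coeff₀-*P : ∀ p r → coeff (p *P r) 0 ≡ coeff p 0 *ℤ coeff r 0
coeff₀-*P []      r = sym (ℤₚ.*-zeroˡ (coeff r 0))
coeff₀-*P (a ∷ p) r = trans (coeff-∷* a p r 0) (ℤₚ.+-identityʳ _)

coeff₀-qFact : ∀ n → coeff (qFact n) 0 ≡ 1ℤ
coeff₀-qFact zero    = refl
coeff₀-qFact (suc n) = trans (coeff₀-*P (qInt (suc n)) (qFact n)) (cong (1ℤ *ℤ_) (coeff₀-qFact n))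

coeff₀-prod-qFact : ∀ as → coeff (prodP (map qFact as)) 0 ≡ 1ℤ
coeff₀-prod-qFact []       = refl
coeff₀-prod-qFact (a ∷ as) = trans (coeff₀-*P (qFact a) (prodP (map qFact as)))
                                   (cong₂ _*ℤ_ (coeff₀-qFact a) (coeff₀-prod-qFact as))

qMultinomial-reverse : ∀ as → qMultinomial (reverse as) ≋ binomials as
qMultinomial-reverse as =
  ÷P-exact (qFact (sumℕ (reverse as))) (prodP (map qFact (reverse as))) (binomials as)
           (coeff₀-prod-qFact (reverse as)) (qFact-sum-reverse as)
           (DegreeBelow-mono {binomials as} degree≤length (DegreeBelow-binomials as))
  where
  degree≤length : suc (binomialsDegree as) ≤ length (qFact (sumℕ (reverse as)))
  degree≤length = ℕₚ.≤-trans (s≤s (binomialsDegree≤triangle as))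
    (ℕₚ.≤-reflexive (sym (trans (length-qFact (sumℕ (reverse as))) (cong (λ n → suc (triangle n)) (sum-reverse as)))))

-- The product of q-binomials over the vertices of a tree

-- For the tree whose root has branches ts (left to right), B ts is the
-- product over all vertices v of the iterated q-binomials of the branch
-- sizes at v: the root contributes [|E(t)|+|E(ts)| ; |E(t)|]_q for its first
-- branch t, and the rest is B of the subtree above t times B of the
-- remaining branches.
B : List Tree → Poly
B []             = 1P
B (node ss ∷ ts) = qbin (suc (edgesF ss)) (edgesF ts) *P (B ss *P B ts)

branchSizes : List Tree → List ℕ
branchSizes ts = map (λ t → suc (edges t)) ts

sum-branchSizes : ∀ ts → sumℕ (branchSizes ts) ≡ edgesF ts
sum-branchSizes []       = refl
sum-branchSizes (t ∷ ts) = cong (suc (edges t) +_) (sum-branchSizes ts)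

-- Π_v W(v) = B: each W(v) is the product of iterated q-binomials of the
-- branch sizes at v, and regrouping the factors gives the recursion of B.
mutual
  prodW≋B : ∀ ts → prodW (node ts) ≋ B ts
  prodW≋B ts = ≋-trans (*P-congˡ (prodWF ts) (qMultinomial-reverse (branchSizes ts))) (binomials-prodWF ts)

  binomials-prodWF : ∀ ts → (binomials (branchSizes ts) *P prodWF ts) ≋ B ts
  binomials-prodWF []             = *P-identityˡ 1P
  binomials-prodWF (node ss ∷ ts) = begin
    (C *P binomials (branchSizes ts)) *P (prodW (node ss) *P prodWF ts)
      ≈⟨ regroup C (binomials (branchSizes ts)) (prodW (node ss)) (prodWF ts) ⟩
    C *P (prodW (node ss) *P (binomials (branchSizes ts) *P prodWF ts))
      ≈⟨ *P-cong (≋-reflexive (cong (qbin (suc (edgesF ss))) (sum-branchSizes ts)))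
                 (*P-cong (prodW≋B ss) (binomials-prodWF ts)) ⟩
    B (node ss ∷ ts) ∎
    where
    open ≋-Reasoning
    C = qbin (suc (edgesF ss)) (sumℕ (branchSizes ts))
    regroup : ∀ C M W R → ((C *P M) *P (W *P R)) ≋ (C *P (W *P (M *P R)))
    regroup = solve-∀ PolyRing

-- Sums over leaves

sumP-++ : ∀ xs ys → sumP (xs ++ ys) ≋ (sumP xs +P sumP ys)
sumP-++ []       ys = ≋-refl
sumP-++ (x ∷ xs) ys = ≋-trans (+P-cong (≋-refl {x}) (sumP-++ xs ys)) (≋-sym (+P-assoc x (sumP xs) (sumP ys)))

sumP-cong : ∀ {A : Set} {P : A → Set} (f g : A → Poly) xs → All P xs →
            (∀ x → P x → f x ≋ g x) → sumP (map f xs) ≋ sumP (map g xs)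
sumP-cong f g []       []         f≋g = ≋-refl
sumP-cong f g (x ∷ xs) (px ∷ pxs) f≋g = +P-cong (f≋g x px) (sumP-cong f g xs pxs f≋g)

sumP-factor : ∀ {A : Set} {P : A → Set} c (f g : A → Poly) xs → All P xs →
              (∀ x → P x → f x ≋ (c *P g x)) → sumP (map f xs) ≋ (c *P sumP (map g xs))
sumP-factor c f g xs pxs f≋cg = ≋-trans (sumP-cong f (λ x → c *P g x) xs pxs f≋cg) (distrib xs)
  where
  distrib : ∀ xs → sumP (map (λ x → c *P g x) xs) ≋ (c *P sumP (map g xs))
  distrib []       = ≋-sym (*P-zeroʳ c)
  distrib (x ∷ xs) = ≋-trans (+P-cong (≋-refl {c *P g x}) (distrib xs))
                             (≋-sym (Poly-distribˡ c (g x) (sumP (map g xs))))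
    where open CommutativeSemiring Poly-commutativeSemiring using () renaming (distribˡ to Poly-distribˡ)

RemovesOneEdge : List Tree → ℕ × List Tree → Set
RemovesOneEdge ts (r , ts') = suc (edgesF ts') ≡ edgesF ts

leafTerm : ℕ × List Tree → Poly
leafTerm (r , ts) = qPow r *P B ts

leafSum : List Tree → Poly
leafSum ts = sumP (map leafTerm (leavesF ts))

-- a leaf of the first branch: the edges of the other branches lie to its right
inFirstBranch : List Tree → ℕ × List Tree → ℕ × List Tree
inFirstBranch ts (r , ss) = (r + edgesF ts , node ss ∷ ts)

inLaterBranch : Tree → ℕ × List Tree → ℕ × List Tree
inLaterBranch t (r , ts) = (r , t ∷ ts)

leavesInFirst : Tree → List Tree → List (ℕ × List Tree)
leavesInFirst (node [])       ts = (edgesF ts , ts) ∷ []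
leavesInFirst (node (s ∷ ss)) ts = map (inFirstBranch ts) (leavesF (s ∷ ss))

leavesF-∷ : ∀ t ts → leavesF (t ∷ ts) ≡ leavesInFirst t ts ++ map (inLaterBranch t) (leavesF ts)
leavesF-∷ (node [])       ts = refl
leavesF-∷ (node (s ∷ ss)) ts = refl

leaves-RemoveOneEdge : ∀ ts → All (RemovesOneEdge ts) (leavesF ts)
leaves-RemoveOneEdge []       = []
leaves-RemoveOneEdge (t ∷ ts) rewrite leavesF-∷ t ts =
  ++⁺ (first t) (map⁺ (All.map (λ {x} → later {x}) (leaves-RemoveOneEdge ts)))
  where
  first : ∀ t → All (RemovesOneEdge (t ∷ ts)) (leavesInFirst t ts)
  first (node [])       = refl ∷ []
  first (node (s ∷ ss)) = map⁺ (All.map (λ {x} → earlier {x}) (leaves-RemoveOneEdge (s ∷ ss)))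
    where
    earlier : ∀ {x} → RemovesOneEdge (s ∷ ss) x → RemovesOneEdge (node (s ∷ ss) ∷ ts) (inFirstBranch ts x)
    earlier {r , ss'} e = cong (λ n → suc n + edgesF ts) e
  later : ∀ {x} → RemovesOneEdge ts x → RemovesOneEdge (t ∷ ts) (inLaterBranch t x)
  later {r , ts'} e = trans (sym (ℕₚ.+-suc (suc (edges t)) (edgesF ts'))) (cong (suc (edges t) +_) e)

-- The sum over the leaves in a later branch: B(T - v) keeps the factor
-- [|E(t)|+|E(ts)|-1 ; |E(t)|]_q · B(above t) for the untouched first branch t.
laterBranchesSum : ∀ ss ts →
  sumP (map leafTerm (map (inLaterBranch (node ss)) (leavesF ts)))
  ≋ ((qbin (suc (edgesF ss)) (pred (edgesF ts)) *P B ss) *P leafSum ts)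
laterBranchesSum ss ts = ≋-trans (≋-reflexive (cong sumP (sym (Listₚ.map-∘ (leavesF ts)))))
  (sumP-factor K _ leafTerm (leavesF ts) (leaves-RemoveOneEdge ts) term)
  where
  K = qbin (suc (edgesF ss)) (pred (edgesF ts)) *P B ss
  regroup : ∀ P C X Y → (P *P (C *P (X *P Y))) ≋ ((C *P X) *P (P *P Y))
  regroup = solve-∀ PolyRing
  term : ∀ x → RemovesOneEdge ts x → leafTerm (inLaterBranch (node ss) x) ≋ (K *P leafTerm x)
  term (r , ts') e = ≋-trans (*P-congʳ (qPow r) (*P-congˡ (B ss *P B ts')
                                (≋-reflexive (cong (qbin (suc (edgesF ss))) (cong pred e)))))
                             (regroup (qPow r) (qbin (suc (edgesF ss)) (pred (edgesF ts))) (B ss) (B ts'))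

mutual
  B-leafRecursion : ∀ t ts → leafSum (t ∷ ts) ≋ B (t ∷ ts)
  B-leafRecursion (node ss) ts = begin
    sumP (map leafTerm (leavesF (node ss ∷ ts)))
      ≡⟨ cong (λ ls → sumP (map leafTerm ls)) (leavesF-∷ (node ss) ts) ⟩
    sumP (map leafTerm (leavesInFirst (node ss) ts ++ map (inLaterBranch (node ss)) (leavesF ts)))
      ≡⟨ cong sumP (Listₚ.map-++ leafTerm (leavesInFirst (node ss) ts) _) ⟩
    sumP (map leafTerm (leavesInFirst (node ss) ts) ++ map leafTerm (map (inLaterBranch (node ss)) (leavesF ts)))
      ≈⟨ sumP-++ (map leafTerm (leavesInFirst (node ss) ts)) _ ⟩
    sumP (map leafTerm (leavesInFirst (node ss) ts)) +P sumP (map leafTerm (map (inLaterBranch (node ss)) (leavesF ts)))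
      ≈⟨ +P-cong (firstBranchSum ss ts) (laterBranchesSum ss ts) ⟩
    ((qPow (edgesF ts) *P qbin (edgesF ss) (edgesF ts)) *P (B ss *P B ts))
      +P ((qbin (suc (edgesF ss)) (pred (edgesF ts)) *P B ss) *P leafSum ts)
      ≈⟨ qPascal-step ss ts ⟩
    B (node ss ∷ ts) ∎
    where open ≋-Reasoning

  -- The sum over the leaves in the first branch t: each term is q^{|E(ts)|}
  -- times the corresponding term for the tree t alone, with the root factor
  -- [|E(t)|+|E(ts)| ; |E(t)|]_q lowered to [|E(t)|-1+|E(ts)| ; |E(t)|-1]_q.
  firstBranchSum : ∀ ss ts →
    sumP (map leafTerm (leavesInFirst (node ss) ts))
    ≋ ((qPow (edgesF ts) *P qbin (edgesF ss) (edgesF ts)) *P (B ss *P B ts))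
  firstBranchSum []       ts = ≋-trans (+P-identityʳ (qPow (edgesF ts) *P B ts)) (units (qPow (edgesF ts)) (B ts))
    where
    units : ∀ P X → (P *P X) ≋ ((P *P 1P) *P (1P *P X))
    units = solve-∀ PolyRing
  firstBranchSum (s ∷ ss) ts = begin
    sumP (map leafTerm (map (inFirstBranch ts) (leavesF (s ∷ ss))))
      ≡⟨ cong sumP (sym (Listₚ.map-∘ (leavesF (s ∷ ss)))) ⟩
    sumP (map (λ x → leafTerm (inFirstBranch ts x)) (leavesF (s ∷ ss)))
      ≈⟨ sumP-factor K _ leafTerm (leavesF (s ∷ ss)) (leaves-RemoveOneEdge (s ∷ ss)) term ⟩
    K *P leafSum (s ∷ ss)
      ≈⟨ *P-congʳ K (B-leafRecursion s ss) ⟩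
    K *P B (s ∷ ss)
      ≈⟨ regroup (qPow b) (qbin (edgesF (s ∷ ss)) b) (B ts) (B (s ∷ ss)) ⟩
    (qPow b *P qbin (edgesF (s ∷ ss)) b) *P (B (s ∷ ss) *P B ts) ∎
    where
    open ≋-Reasoning
    b = edgesF ts
    K = (qPow b *P qbin (edgesF (s ∷ ss)) b) *P B ts
    regroup : ∀ P C Y X → ((P *P C) *P Y) *P X ≋ (P *P C) *P (X *P Y)
    regroup = solve-∀ PolyRing
    shuffle : ∀ Pr Pb C Y X → ((Pr *P Pb) *P (C *P (X *P Y))) ≋ (((Pb *P C) *P Y) *P (Pr *P X))
    shuffle = solve-∀ PolyRing
    term : ∀ x → RemovesOneEdge (s ∷ ss) x → leafTerm (inFirstBranch ts x) ≋ (K *P leafTerm x)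
    term (r , ss') e = ≋-trans (*P-cong (qPow-+ r b) (*P-congˡ (B ss' *P B ts) (≋-reflexive (cong (λ n → qbin n b) e))))
                               (shuffle (qPow r) (qPow b) _ (B ts) (B ss'))

  -- The two sums combine by the q-Pascal rule
  --   [e+b ; e] = q^b [e-1+b ; e-1] + [e-1+b ; e]   (e = |E(t)| ≥ 1, b = |E(ts)|),
  -- using the recursion for the later branches when there are any.
  qPascal-step : ∀ ss ts →
    (((qPow (edgesF ts) *P qbin (edgesF ss) (edgesF ts)) *P (B ss *P B ts))
      +P ((qbin (suc (edgesF ss)) (pred (edgesF ts)) *P B ss) *P leafSum ts))
    ≋ B (node ss ∷ ts)
  qPascal-step ss [] rewrite qbin-zeroʳ (edgesF ss) = begin
    ((1P *P 1P) *P (B ss *P 1P)) +P ((1P *P B ss) *P [])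
      ≈⟨ +P-cong (≋-refl {(1P *P 1P) *P (B ss *P 1P)}) (*P-zeroʳ (1P *P B ss)) ⟩
    ((1P *P 1P) *P (B ss *P 1P)) +P []
      ≈⟨ +P-identityʳ _ ⟩
    (1P *P 1P) *P (B ss *P 1P)
      ≈⟨ units (B ss) ⟩
    1P *P (B ss *P 1P) ∎
    where
    open ≋-Reasoning
    units : ∀ X → ((1P *P 1P) *P (X *P 1P)) ≋ (1P *P (X *P 1P))
    units = solve-∀ PolyRing
  qPascal-step ss (t ∷ ts) = begin
    ((P *P C₁) *P (X *P Y)) +P ((C₂ *P X) *P leafSum (t ∷ ts))
      ≈⟨ +P-cong (≋-refl {(P *P C₁) *P (X *P Y)}) (*P-congʳ (C₂ *P X) (B-leafRecursion t ts)) ⟩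
    ((P *P C₁) *P (X *P Y)) +P ((C₂ *P X) *P Y)
      ≈⟨ collect P C₁ C₂ X Y ⟩
    ((P *P C₁) +P C₂) *P (X *P Y) ∎
    where
    open ≋-Reasoning
    P = qPow (edgesF (t ∷ ts))
    C₁ = qbin (edgesF ss) (edgesF (t ∷ ts))
    C₂ = qbin (suc (edgesF ss)) (edges t + edgesF ts)
    X = B ss
    Y = B (t ∷ ts)
    collect : ∀ P C₁ C₂ X Y → (((P *P C₁) *P (X *P Y)) +P ((C₂ *P X) *P Y)) ≋ (((P *P C₁) +P C₂) *P (X *P Y))
    collect = solve-∀ PolyRing

plucking≋B : ∀ n ts → edgesF ts ≡ n → plucking n ts ≋ B ts
plucking≋B zero    []       refl = ≋-refl
plucking≋B (suc n) (t ∷ ts) e    = ≋-trans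
  (sumP-cong _ leafTerm (leavesF (t ∷ ts)) (leaves-RemoveOneEdge (t ∷ ts))
             (λ { (r , ts') e' → *P-congʳ (qPow r) (plucking≋B n ts' (ℕₚ.suc-injective (trans e' e))) }))
  (B-leafRecursion t ts)

corollary2p3 : (T : Tree) → Q T ≈P prodW T
corollary2p3 (node ts) = coeff-≡ (begin
  Q (node ts)             ≡⟨⟩
  plucking (edgesF ts) ts ≈⟨ plucking≋B (edgesF ts) ts refl ⟩
  B ts                    ≈⟨ prodW≋B ts ⟨
  prodW (node ts)         ∎)
  where open ≋-Reasoning
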